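{- There exists a computable function $C_6\colon\mathbb N\to\mathbb N$ such that the following holds. Let $W$ be an infinite word with recurrence bound $C_{rec}$ and $S$ a Rauzy scheme for $W$. For every collecting vertex of $S$, take the natural right extension of the unique edge leaving it; let $\{s_i\}$ be the resulting set of symmetric paths. Then for any two paths $s_1,s_2\in\{s_i\}$ the lengths $|F(s_1)|$ and $|F(s_2)|$ differ by a factor of at most $C_6(C_{rec})$.
   Context: For a uniformly recurrent infinite word $W$, $P_2(N)$ is the least number such that every factor of length $P_2(N)$ contains all factors of length $N$; $C$ is a recurrence bound if $P_2(N)\le CN$ for all $N$. $u\sqsubseteq w$: factor; $u\sqsubseteq_k w$: at least $k$ occurrences. A graph with words is a strongly connected directed multigraph each edge $e$ of which carries a front word $F(e)$ and a back word $B(e)$, every vertex being distributing (in-degree $1$, out-degree $>1$) or collecting (in-degree $>1$, out-degree $1$). Paths are sequences of consecutive edges with edge records; a path is symmetric if its first edge starts at a collecting vertex and its last edge ends at a distributing vertex. For $s=v_1\dots v_n$: $F(s)$ = ordered concatenation of front words of $v_1$ and all $v_i$ starting at a distributing vertex; $B(s)$ = ordered concatenation of back words of all $v_i$ ending at a collecting vertex and of $v_n$. $S$ is a Rauzy scheme for $W$ if: (1) strongly connected, more than one edge; (2) front words of edges leaving one distributing vertex have pairwise distinct first letters, back words of edges entering one collecting vertex have pairwise distinct last letters; (3) $F(s)=B(s)$ for symmetric $s$; (4) for symmetric $s_1,s_2$, $F(s_1)\sqsubseteq_kF(s_2)$ implies the edge record of $s_1$ occurs at least $k$ times in that of $s_2$;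 (5) edge words are factors of $W$; (6) every factor of $W$ is a factor of $F(s)$ for some symmetric $s$; (7) for every edge $e$ there is a factor $u_e$ of $W$ such that every symmetric $s$ with $u_e\sqsubseteq F(s)$ passes through $e$. The natural right extension of a path $s$ is the minimal path beginning with $s$ and ending at a distributing vertex. -}

module Defs where

open import Data.Nat using (ℕ; zero; suc; _+_; _*_; _≤_; _<_)
open import Data.Nat.Properties using (_≟_; _<?_)
open import Data.Fin using (Fin)
import Data.Fin as Fin
open import Data.List using (List; []; _∷_; _++_; length; map; upTo; filter; allFin)
open import Data.Product using (Σ; _×_; _,_; ∃)
open import Data.Sum using (_⊎_)
open import Data.Bool using (Bool; if_then_else_)
open import Relation.Nullary using (¬_; Dec; does)
open import Relation.Nullary.Decidable using (_×-dec_)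
open import Relation.Binary.PropositionalEquality using (_≡_; _≢_)
open import Data.List.Membership.Propositional using (_∈_)

_⊑_ : {A : Set} → List A → List A → Set
_⊑_ {A} u w = Σ (List A) λ p → Σ (List A) λ s → w ≡ p ++ u ++ s

OccursAt : {A : Set} → List A → List A → ℕ → Set
OccursAt {A} u w i = Σ (List A) λ p → Σ (List A) λ s → length p ≡ i × w ≡ p ++ u ++ s

OccursAtLeast : {A : Set} → ℕ → List A → List A → Set
OccursAtLeast k u w =
  Σ (Fin k → ℕ) λ f → (∀ i j → i Fin.< j → f i < f j) × (∀ i → OccursAt u w (f i))

sub : {A : Set} → (ℕ → A) → ℕ → ℕ → List A
sub W i n = map (λ k → W (i + k)) (upTo n)

FactorOf : {A : Set} → List A → (ℕ → A) → Set
FactorOf u W = Σ ℕ λ i → u ≡ sub W i (length u)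

Window : {A : Set} → (ℕ → A) → ℕ → ℕ → Set
Window W N L = ∀ i j → sub W j N ⊑ sub W i L

IsP2 : {A : Set} → (ℕ → A) → ℕ → ℕ → Set
IsP2 W N L = Window W N L × (∀ L' → Window W N L' → L ≤ L')

RecurrenceBound : {A : Set} → (ℕ → A) → ℕ → Set
RecurrenceBound W C = ∀ N → Σ ℕ λ L → IsP2 W N L × L ≤ C * N

record Graph (A : Set) : Set where
  field
    nV    : ℕ
    nE    : ℕ
    src   : Fin nE → Fin nV
    tgt   : Fin nE → Fin nV
    front : Fin nE → List A
    back  : Fin nE → List A

module _ {A : Set} (G : Graph A) where
  open Graph G

  Vertex Edge : Set
  Vertex = Fin nV
  Edge   = Fin nE

  indeg outdeg : Vertex → ℕ
  indeg  v = length (filter (λ e → tgt e Fin.≟ v) (allFin nE))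
  outdeg v = length (filter (λ e → src e Fin.≟ v) (allFin nE))

  Distributing Collecting : Vertex → Set
  Distributing v = indeg v ≡ 1 × 1 < outdeg v
  Collecting   v = 1 < indeg v × outdeg v ≡ 1

  distributing? : (v : Vertex) → Dec (Distributing v)
  distributing? v = (indeg v ≟ 1) ×-dec (1 <? outdeg v)

  collecting? : (v : Vertex) → Dec (Collecting v)
  collecting? v = (1 <? indeg v) ×-dec (outdeg v ≟ 1)

  data IsPath : List Edge → Set where
    single : ∀ e → IsPath (e ∷ [])
    cons   : ∀ e e' es → tgt e ≡ src e' → IsPath (e' ∷ es) → IsPath (e ∷ e' ∷ es)

  StartsAt : List Edge → Vertex → Set
  StartsAt s v = Σ Edge λ e → Σ (List Edge) λ es → s ≡ e ∷ es × src e ≡ v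

  EndsAt : List Edge → Vertex → Set
  EndsAt s v = Σ Edge λ e → Σ (List Edge) λ es → s ≡ es ++ e ∷ [] × tgt e ≡ v

  Symmetric : List Edge → Set
  Symmetric s = IsPath s
    × Σ Vertex (λ v → StartsAt s v × Collecting v)
    × Σ Vertex (λ v → EndsAt s v × Distributing v)

  Frest : List Edge → List A
  Frest [] = []
  Frest (e ∷ es) =
    (if does (distributing? (src e)) then front e else []) ++ Frest es

  F : List Edge → List A
  F [] = []
  F (e ∷ es) = front e ++ Frest es

  B : List Edge → List A
  B [] = []
  B (e ∷ []) = back e
  B (e ∷ e' ∷ es) =
    (if does (collecting? (tgt e)) then back e else []) ++ B (e' ∷ es)

  NaturalRightExtension : List Edge → List Edge → Set
  NaturalRightExtension s t =
    IsPath t × (Σ (List Edge) λ r → t ≡ s ++ r)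
    × Σ Vertex (λ v → EndsAt t v × Distributing v)
    × (∀ t' → IsPath t' → (Σ (List Edge) λ r → t' ≡ s ++ r)
            → Σ Vertex (λ v → EndsAt t' v × Distributing v)
            → length t ≤ length t')

  IsGraphWithWords : Set
  IsGraphWithWords =
    (∀ u v → u ≡ v ⊎ Σ (List Edge) λ s → IsPath s × StartsAt s u × EndsAt s v)
    × (∀ v → Distributing v ⊎ Collecting v)

  record RauzyScheme (W : ℕ → A) : Set where
    field
      graphWithWords : IsGraphWithWords
      moreThanOneEdge : 1 < nE
      frontDistinct : ∀ e e' → src e ≡ src e' → Distributing (src e) → e ≢ e' →
        Σ A λ a → Σ A λ a' → Σ (List A) λ w → Σ (List A) λ w' →
          front e ≡ a ∷ w × front e' ≡ a' ∷ w' × a ≢ a'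
      backDistinct : ∀ e e' → tgt e ≡ tgt e' → Collecting (tgt e) → e ≢ e' →
        Σ A λ a → Σ A λ a' → Σ (List A) λ w → Σ (List A) λ w' →
          back e ≡ w ++ a ∷ [] × back e' ≡ w' ++ a' ∷ [] × a ≢ a'
      FB : ∀ s → Symmetric s → F s ≡ B s
      occurrences : ∀ s₁ s₂ k → Symmetric s₁ → Symmetric s₂ →
        OccursAtLeast k (F s₁) (F s₂) → OccursAtLeast k s₁ s₂
      frontFactor : ∀ e → FactorOf (front e) W
      backFactor  : ∀ e → FactorOf (back e) W
      covering : ∀ u → FactorOf u W → Σ (List Edge) λ s → Symmetric s × u ⊑ F s
      edgeWitness : ∀ e → Σ (List A) λ u → FactorOf u W ×
        (∀ s → Symmetric s → u ⊑ F s → e ∈ s)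

-- Let s be the natural right extension of an edge e leaving a collecting
-- vertex. By minimality no proper prefix of s ends at a distributing vertex,
-- so F(s) is the front word of e, and a symmetric path (which ends at a
-- distributing vertex) can occur in s only as a suffix, i.e. at most once.
-- By axiom (4) of a Rauzy scheme, F(s₂) then occurs at most once in F(s₁).
-- On the other hand, with L = P₂(|F(s₂)|), every factor of W of length
-- greater than 2L contains two disjoint windows of length L, each containing
-- F(s₂). Hence |F(s₁)| ≤ 2L ≤ 2 C_rec |F(s₂)|, and C₆(C) = 2C works.
module Submission where

open import Defs
open import Data.Nat using (ℕ; zero; suc; _+_; _*_; _≤_; _<_; z≤n; s≤s; _≤?_)
open import Data.Nat.Properties
open import Data.List using (List; []; _∷_; _++_; length; map; upTo; applyUpTo)
open import Data.List.Properties
  using (∷-injectiveˡ; ++-identityʳ; ++-assoc; length-++; map-++; map-∘; map-cong; map-upTo)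
open import Data.Product using (Σ; _,_; proj₁; proj₂)
open import Data.Fin using (Fin)
import Data.Fin as Fin
open import Data.Bool using (if_then_else_)
open import Function using (_∘_)
open import Relation.Nullary using (¬_; yes; no; does; contradiction)
open import Relation.Nullary.Decidable using (dec-false)
open import Relation.Binary.PropositionalEquality

module _ {A : Set} where

  ++-length-≤⇒≡[] : (xs ys : List A) → length (xs ++ ys) ≤ length xs → ys ≡ []
  ++-length-≤⇒≡[] xs []      _  = refl
  ++-length-≤⇒≡[] xs (y ∷ ys) le =
    contradiction (subst (_≤ length xs) (length-++ xs) le) (m+1+n≰m (length xs))

  ⊑⇒OccursAt : ∀ {u w : List A} (u⊑w : u ⊑ w) → OccursAt u w (length (proj₁ u⊑w))
  ⊑⇒OccursAt (p , s , w≡) = p , s , refl , w≡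

  OccursAt-++ʳ : ∀ {u w : List A} {i} (v : List A) → OccursAt u w i → OccursAt u (w ++ v) i
  OccursAt-++ʳ v (p , s , p≡ , w≡) =
    p , s ++ v , p≡ , trans (cong (_++ v) w≡) (trans (++-assoc p _ v) (cong (p ++_) (++-assoc _ s v)))

  OccursAt-++ˡ : ∀ {u w : List A} {i} (v : List A) → OccursAt u w i → OccursAt u (v ++ w) (length v + i)
  OccursAt-++ˡ v (p , s , p≡ , w≡) =
    v ++ p , s , trans (length-++ v) (cong (length v +_) p≡) , trans (cong (v ++_) w≡) (sym (++-assoc v p _))

  OccursAt⇒+≤ : ∀ {u w : List A} {i} → OccursAt u w i → i + length u ≤ length w
  OccursAt⇒+≤ {u} {w} (p , s , refl , w≡) = begin
    length p + length u          ≡⟨ length-++ p ⟨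
    length (p ++ u)              ≤⟨ m≤m+n _ (length s) ⟩
    length (p ++ u) + length s   ≡⟨ length-++ (p ++ u) ⟨
    length ((p ++ u) ++ s)       ≡⟨ cong length (++-assoc p u s) ⟩
    length (p ++ u ++ s)         ≡⟨ cong length w≡ ⟨
    length w                     ∎
    where open ≤-Reasoning

  OccursAtLeast-++ʳ : ∀ {k} {u w : List A} (v : List A) → OccursAtLeast k u w → OccursAtLeast k u (w ++ v)
  OccursAtLeast-++ʳ v (f , f-mono , occ) = f , f-mono , OccursAt-++ʳ v ∘ occ

  occursTwice : ∀ {u w : List A} {i j} → i < j → OccursAt u w i → OccursAt u w j → OccursAtLeast 2 u w
  occursTwice {u} {w} {i} {j} i<j occᵢ occⱼ = position , increasing , occurs
    where
    position : Fin 2 → ℕ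
    position Fin.zero    = i
    position (Fin.suc _) = j

    increasing : ∀ a b → a Fin.< b → position a < position b
    increasing Fin.zero           (Fin.suc Fin.zero) _         = i<j
    increasing (Fin.suc Fin.zero) (Fin.suc Fin.zero) (s≤s ())

    occurs : ∀ a → OccursAt u w (position a)
    occurs Fin.zero    = occᵢ
    occurs (Fin.suc _) = occⱼ

  suffixOnly⇒¬OccursAtLeast2 : ∀ {u w : List A} → (∀ i → OccursAt u w i → i + length u ≡ length w) →
                               ¬ OccursAtLeast 2 u w
  suffixOnly⇒¬OccursAtLeast2 {u} end (f , f-mono , occ) =
    <-irrefl (+-cancelʳ-≡ (length u) (f Fin.zero) (f (Fin.suc Fin.zero))
               (trans (end _ (occ Fin.zero)) (sym (end _ (occ (Fin.suc Fin.zero))))))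
             (f-mono Fin.zero (Fin.suc Fin.zero) (s≤s z≤n))

applyUpTo-+ : {B : Set} (f : ℕ → B) (m n : ℕ) →
              applyUpTo f (m + n) ≡ applyUpTo f m ++ applyUpTo (f ∘ (m +_)) n
applyUpTo-+ f zero    n = refl
applyUpTo-+ f (suc m) n = cong (f 0 ∷_) (applyUpTo-+ (f ∘ suc) m n)

module _ {A : Set} (W : ℕ → A) where

  sub-+ : ∀ a m n → sub W a (m + n) ≡ sub W a m ++ sub W (a + m) n
  sub-+ a m n = begin
    map h (upTo (m + n))                              ≡⟨ cong (map h) (applyUpTo-+ (λ k → k) m n) ⟩
    map h (upTo m ++ applyUpTo (m +_) n)              ≡⟨ map-++ h (upTo m) _ ⟩
    sub W a m ++ map h (applyUpTo (m +_) n)           ≡⟨ cong (λ ks → sub W a m ++ map h ks) (map-upTo (m +_) n) ⟨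
    sub W a m ++ map h (map (m +_) (upTo n))          ≡⟨ cong (sub W a m ++_) (map-∘ (upTo n)) ⟨
    sub W a m ++ map (h ∘ (m +_)) (upTo n)            ≡⟨ cong (sub W a m ++_) (map-cong (λ k → cong W (+-assoc a m k)) (upTo n)) ⟨
    sub W a m ++ sub W (a + m) n                      ∎
    where
    open ≡-Reasoning

    h : ℕ → A
    h k = W (a + k)

  -- The gap of one letter between the two windows keeps the two occurrences
  -- distinct even when n = 0.
  twoWindows-occursTwice : ∀ {n L} → Window W n L →
                           ∀ a b → OccursAtLeast 2 (sub W b n) (sub W a (L + suc L))
  twoWindows-occursTwice {n} {L} window a b =
    subst (OccursAtLeast 2 (sub W b n)) (sym split) (occursTwice i<j first second)
    where
    Left Gap Right : List A
    Left  = sub W a L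
    Gap   = sub W (a + L) 1
    Right = sub W (a + L + 1) L

    split : sub W a (L + suc L) ≡ Left ++ Gap ++ Right
    split = trans (sub-+ a L (suc L)) (cong (Left ++_) (sub-+ (a + L) 1 L))

    i j : ℕ
    i = length (proj₁ (window a b))
    j = length Left + (length Gap + length (proj₁ (window (a + L + 1) b)))

    first : OccursAt (sub W b n) (Left ++ Gap ++ Right) i
    first = OccursAt-++ʳ (Gap ++ Right) (⊑⇒OccursAt (window a b))

    second : OccursAt (sub W b n) (Left ++ Gap ++ Right) j
    second = OccursAt-++ˡ Left (OccursAt-++ˡ Gap (⊑⇒OccursAt (window (a + L + 1) b)))

    i<j : i < j
    i<j = ≤-<-trans (m+n≤o⇒m≤o i (OccursAt⇒+≤ (⊑⇒OccursAt (window a b))))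
                    (m<m+n (length Left) (s≤s z≤n))

  longFactor-occursTwice : ∀ {n L m} → Window W n L → 2 * L < m →
                           ∀ a b → OccursAtLeast 2 (sub W b n) (sub W a m)
  longFactor-occursTwice {n} {L} {m} window 2L<m a b with m≤n⇒∃[o]m+o≡n 2L<m
  ... | r , m≡ = subst (OccursAtLeast 2 (sub W b n) ∘ sub W a) m≡′
                   (subst (OccursAtLeast 2 (sub W b n)) (sym (sub-+ a (L + suc L) r))
                     (OccursAtLeast-++ʳ _ (twoWindows-occursTwice window a b)))
    where
    m≡′ : L + suc L + r ≡ m
    m≡′ = trans (cong (λ x → x + r) (trans (+-suc L L) (cong (λ x → suc (L + x)) (sym (+-identityʳ L))))) m≡

  onceOccurring-length≤ : ∀ {u v L} → FactorOf u W → FactorOf v W → Window W (length u) L →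
                          ¬ OccursAtLeast 2 u v → length v ≤ 2 * L
  onceOccurring-length≤ {v = v} {L} (b , u≡) (a , v≡) window once with length v ≤? 2 * L
  ... | yes v≤2L = v≤2L
  ... | no  v≰2L = contradiction
        (subst₂ (OccursAtLeast 2) (sym u≡) (sym v≡)
          (longFactor-occursTwice window (≰⇒> v≰2L) a b))
        once

module _ {A : Set} (S : Graph A) where
  open Graph S

  IsPath-prefix : ∀ x xs ys → IsPath S ((x ∷ xs) ++ ys) → IsPath S (x ∷ xs)
  IsPath-prefix x []        ys _                          = single x
  IsPath-prefix x (x′ ∷ xs) ys (cons .x .x′ .(xs ++ ys) eq p) = cons x x′ xs eq (IsPath-prefix x′ xs ys p)

  IsPath-link : ∀ xs e e′ r → IsPath S (xs ++ e ∷ e′ ∷ r) → tgt e ≡ src e′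
  IsPath-link []             e e′ r (cons .e .e′ .r eq _)                = eq
  IsPath-link (x ∷ [])       e e′ r (cons .x .e .(e′ ∷ r) _ p)           = IsPath-link [] e e′ r p
  IsPath-link (x ∷ x′ ∷ xs) e e′ r (cons .x .x′ .(xs ++ e ∷ e′ ∷ r) _ p) = IsPath-link (x′ ∷ xs) e e′ r p

  nre-distributingPrefix-isWhole : ∀ {s₀ s v} → NaturalRightExtension S s₀ s →
    ∀ t ys → s ≡ t ++ ys → (Σ (List (Edge S)) λ r → t ≡ s₀ ++ r) →
    EndsAt S t v → Distributing S v → ys ≡ []
  nre-distributingPrefix-isWhole _ [] ys _ _ (_ , [] , () , _) _
  nre-distributingPrefix-isWhole _ [] ys _ _ (_ , _ ∷ _ , () , _) _
  nre-distributingPrefix-isWhole {v = v} (s-path , _ , _ , minimal) (x ∷ xs) ys s≡ extends ends d =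
    ++-length-≤⇒≡[] (x ∷ xs) ys (subst (_≤ length (x ∷ xs)) (cong length s≡)
      (minimal (x ∷ xs) (IsPath-prefix x xs ys (subst (IsPath S) s≡ s-path)) extends (v , ends , d)))

  module _ {e₀ : Edge S} {s : List (Edge S)} (nre : NaturalRightExtension S (e₀ ∷ []) s) where

    private
      s-path : IsPath S s
      s-path = proj₁ nre

    distributingPrefix-isWhole : ∀ {v} t ys → s ≡ t ++ ys → EndsAt S t v → Distributing S v → ys ≡ []
    distributingPrefix-isWhole [] ys _ (_ , [] , () , _) _
    distributingPrefix-isWhole [] ys _ (_ , _ ∷ _ , () , _) _
    distributingPrefix-isWhole (x ∷ xs) ys s≡ ends d with proj₁ (proj₂ nre)
    ... | r , s≡e₀∷r =
      nre-distributingPrefix-isWhole nre (x ∷ xs) ys s≡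
        (xs , cong (_∷ xs) (∷-injectiveˡ (trans (sym s≡) s≡e₀∷r))) ends d

    interior-¬distributing : ∀ xs e′ e r → s ≡ xs ++ e′ ∷ e ∷ r → ¬ Distributing S (src e)
    interior-¬distributing xs e′ e r s≡ d
      with distributingPrefix-isWhole (xs ++ e′ ∷ []) (e ∷ r)
             (trans s≡ (sym (++-assoc xs (e′ ∷ []) (e ∷ r))))
             (e′ , xs , refl , IsPath-link xs e′ e r (subst (IsPath S) s≡ s-path)) d
    ... | ()

    Frest-interior≡[] : ∀ xs e′ r → s ≡ xs ++ e′ ∷ r → Frest S r ≡ []
    Frest-interior≡[] xs e′ []      _  = refl
    Frest-interior≡[] xs e′ (e ∷ r) s≡ = begin
      (if does (distributing? S (src e)) then front e else []) ++ Frest S r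
        ≡⟨ cong (λ b → (if b then front e else []) ++ Frest S r)
                (dec-false (distributing? S (src e)) (interior-¬distributing xs e′ e r s≡)) ⟩
      Frest S r
        ≡⟨ Frest-interior≡[] (xs ++ e′ ∷ []) e r (trans s≡ (sym (++-assoc xs (e′ ∷ []) (e ∷ r)))) ⟩
      []  ∎
      where open ≡-Reasoning

    F-nre≡front : F S s ≡ front e₀
    F-nre≡front with proj₁ (proj₂ nre)
    ... | r , refl = trans (cong (front e₀ ++_) (Frest-interior≡[] [] e₀ r refl)) (++-identityʳ (front e₀))

    occurrence-isSuffix : ∀ {t v} → EndsAt S t v → Distributing S v →
                          ∀ i → OccursAt t s i → i + length t ≡ length s
    occurrence-isSuffix {t} (e , es , t≡ , tgt≡) d i (p , q , refl , s≡) = begin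
      length p + length t       ≡⟨ length-++ p ⟨
      length (p ++ t)           ≡⟨ cong length (++-identityʳ (p ++ t)) ⟨
      length ((p ++ t) ++ [])   ≡⟨ cong (λ ys → length ((p ++ t) ++ ys)) q≡[] ⟨
      length ((p ++ t) ++ q)    ≡⟨ cong length s≡′ ⟨
      length s                  ∎
      where
      open ≡-Reasoning

      s≡′ : s ≡ (p ++ t) ++ q
      s≡′ = trans s≡ (sym (++-assoc p t q))

      ends : EndsAt S (p ++ t) _
      ends = e , p ++ es , trans (cong (p ++_) t≡) (sym (++-assoc p es (e ∷ []))) , tgt≡

      q≡[] : q ≡ []
      q≡[] = distributingPrefix-isWhole (p ++ t) q s≡′ ends d

    nre-symmetric : Collecting S (src e₀) → Symmetric S s
    nre-symmetric col with proj₂ nre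
    ... | (r , s≡) , ends , _ = s-path , (src e₀ , (e₀ , r , s≡ , refl) , col) , ends

  front-occursAtMostOnce : ∀ {W e₁ e₂ s₁ s₂} → RauzyScheme S W →
    Collecting S (src e₁) → Collecting S (src e₂) →
    NaturalRightExtension S (e₁ ∷ []) s₁ → NaturalRightExtension S (e₂ ∷ []) s₂ →
    ¬ OccursAtLeast 2 (front e₂) (front e₁)
  front-occursAtMostOnce {s₁ = s₁} {s₂} R col₁ col₂ nre₁ nre₂@(_ , _ , (_ , ends₂ , dist₂) , _) twice =
    suffixOnly⇒¬OccursAtLeast2
      (occurrence-isSuffix nre₁ ends₂ dist₂)
      (RauzyScheme.occurrences R s₂ s₁ 2 (nre-symmetric nre₂ col₂) (nre-symmetric nre₁ col₁)
        (subst₂ (OccursAtLeast 2) (sym (F-nre≡front nre₂)) (sym (F-nre≡front nre₁)) twice))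

natural-right-extensions-length-ratio : ∀ {A : Set} (W : ℕ → A) (c : ℕ) → RecurrenceBound W c →
  (S : Graph A) → RauzyScheme S W →
  ∀ (e₁ e₂ : Edge S) (s₁ s₂ : List (Edge S)) →
  Collecting S (Graph.src S e₁) → Collecting S (Graph.src S e₂) →
  NaturalRightExtension S (e₁ ∷ []) s₁ → NaturalRightExtension S (e₂ ∷ []) s₂ →
  length (F S s₁) ≤ 2 * c * length (F S s₂)
natural-right-extensions-length-ratio W c rb S R e₁ e₂ s₁ s₂ col₁ col₂ nre₁ nre₂
  with rb (length (Graph.front S e₂))
... | L , (window , _) , L≤cn = begin
  length (F S s₁)             ≡⟨ cong length (F-nre≡front S nre₁) ⟩
  length (front e₁)           ≤⟨ onceOccurring-length≤ W (frontFactor e₂) (frontFactor e₁) window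
                                   (front-occursAtMostOnce S R col₁ col₂ nre₁ nre₂) ⟩
  2 * L                       ≤⟨ *-monoʳ-≤ 2 L≤cn ⟩
  2 * (c * length (front e₂)) ≡⟨ *-assoc 2 c _ ⟨
  2 * c * length (front e₂)   ≡⟨ cong (λ w → 2 * c * length w) (F-nre≡front S nre₂) ⟨
  2 * c * length (F S s₂)     ∎
  where
  open Graph S
  open RauzyScheme R
  open ≤-Reasoning

lemma11 : Σ (ℕ → ℕ) λ C₆ →
    ∀ {A : Set} (W : ℕ → A) (Crec : ℕ) → RecurrenceBound W Crec →
    (S : Graph A) → RauzyScheme S W →
    ∀ (e₁ e₂ : Edge S) (s₁ s₂ : List (Edge S)) →
    Collecting S (Graph.src S e₁) → Collecting S (Graph.src S e₂) →
    NaturalRightExtension S (e₁ ∷ []) s₁ → NaturalRightExtension S (e₂ ∷ []) s₂ →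
    length (F S s₁) ≤ C₆ Crec * length (F S s₂)
lemma11 = (2 *_) , natural-right-extensions-length-ratio
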